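{- Let $G$ be a singular simple graph whose set $CV$ of core vertices is independent, and let $\mathbf{Q}$ be the $|CV|\times|N(CV)|$ submatrix of the adjacency matrix of $G$ with rows indexed by $CV$ and columns indexed by $N(CV)$. Then $\eta(G)=|CV|-\operatorname{rank}(\mathbf{Q})$.
   Context: $\eta(G)=\dim\ker\mathbf{A}$ is the nullity of the $\{0,1\}$-adjacency matrix $\mathbf{A}$; $G$ is singular if $\eta(G)>0$. A vertex $v$ is a core vertex if some $\mathbf{x}\in\ker\mathbf{A}$ has $x_v\neq0$; $CV$ is the set of core vertices. $N(CV)$ is the set of vertices adjacent to at least one core vertex.
   Formalization: The kernel of $\mathbf{A}$ that defines $\eta(G)$ and the core vertices, together with the rank of $\mathbf{Q}$, is taken over ℚ. -}

module Defs where

open import Data.Nat using (ℕ; zero; suc)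
open import Data.Fin using (Fin; zero; suc)
open import Data.Bool using (Bool; true; false; if_then_else_)
open import Data.Rational using (ℚ; 0ℚ; 1ℚ; _+_; _*_)
open import Data.Product using (Σ; ∃; _×_; _,_)
open import Relation.Binary.PropositionalEquality using (_≡_; _≢_)
open import Relation.Nullary using (¬_)

record SimpleGraph (n : ℕ) : Set where
  field
    adj   : Fin n → Fin n → Bool
    sym   : ∀ u v → adj u v ≡ adj v u
    loopless : ∀ v → adj v v ≡ false
open SimpleGraph public

-- Vectors and matrices over ℚ (the {0,1}-adjacency matrix has rational entries;
-- rank/nullity of a rational matrix are the same over ℚ and ℝ).
Vector : ℕ → Set
Vector n = Fin n → ℚ

Matrix : ℕ → ℕ → Set
Matrix m n = Fin m → Fin n → ℚ

sumFin : ∀ {n} → (Fin n → ℚ) → ℚ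
sumFin {zero}  f = 0ℚ
sumFin {suc n} f = f zero + sumFin (λ i → f (suc i))

_·_ : ∀ {m n} → Matrix m n → Vector n → Vector m
(M · x) i = sumFin (λ j → M i j * x j)

Subspace : ℕ → Set₁
Subspace n = Vector n → Set

LinIndep : ∀ {k n} → (Fin k → Vector n) → Set
LinIndep {k} {n} v =
  (c : Fin k → ℚ) → (∀ i → sumFin (λ j → c j * v j i) ≡ 0ℚ) → ∀ j → c j ≡ 0ℚ

IsDim : ∀ {n} → Subspace n → ℕ → Set
IsDim {n} S d =
  (Σ (Fin d → Vector n) λ v → (∀ j → S (v j)) × LinIndep v)
  × (¬ Σ (Fin (suc d) → Vector n) λ v → (∀ j → S (v j)) × LinIndep v)

Ker : ∀ {m n} → Matrix m n → Subspace n
Ker M x = ∀ i → (M · x) i ≡ 0ℚ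

ColSpace : ∀ {m n} → Matrix m n → Subspace m
ColSpace M y = Σ (Vector _) λ x → ∀ i → (M · x) i ≡ y i

IsRank : ∀ {m n} → Matrix m n → ℕ → Set
IsRank M r = IsDim (ColSpace M) r

adjMat : ∀ {n} → SimpleGraph n → Matrix n n
adjMat G u v = if adj G u v then 1ℚ else 0ℚ

IsNullity : ∀ {n} → SimpleGraph n → ℕ → Set
IsNullity G d = IsDim (Ker (adjMat G)) d

IsCore : ∀ {n} → SimpleGraph n → Fin n → Set
IsCore G v = Σ (Vector _) λ x → Ker (adjMat G) x × x v ≢ 0ℚ

InNCV : ∀ {n} → SimpleGraph n → Fin n → Set
InNCV G v = Σ (Fin _) λ u → IsCore G u × adj G u v ≡ true

CoreIndependent : ∀ {n} → SimpleGraph n → Set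
CoreIndependent G = ∀ u v → IsCore G u → IsCore G v → adj G u v ≡ false

Enumerates : ∀ {k n} → (Fin n → Set) → (Fin k → Fin n) → Set
Enumerates {k} {n} P e =
  (∀ i j → e i ≡ e j → i ≡ j) × (∀ v → P v → Σ (Fin k) λ i → e i ≡ v) × (∀ i → P (e i))

subMatrix : ∀ {n k m} → Matrix n n → (Fin k → Fin n) → (Fin m → Fin n) → Matrix k m
subMatrix A r c i j = A (r i) (c j)

module Submission where

-- A kernel vector x of A vanishes off CV, so it is the extension by zero of its restriction
-- z = x ∘ cv. The equations (A x)ᵤ = 0 for u ∈ N(CV) say exactly that z lies in the left
-- kernel of Q, and every other row of A meets no core vertex. Restriction is therefore an
-- isomorphism from ker A onto the left kernel of Q, which has dimension |CV| − rank Q.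
-- Over ℚ this count is made by orthogonality: the left kernel of Q is orthogonal to its
-- column space, and the dot product is definite.

open import Defs hiding (sym)
open import Data.Fin using (Fin; zero; suc)

module LinearAlgebra where

  open import Algebra.Bundles using (CommutativeRing)
  open import Data.Nat as ℕ using (zero; suc; s≤s)
  import Data.Nat.Properties as ℕ
  open import Data.Fin as Fin using (punchIn; splitAt; _↑ˡ_; _↑ʳ_)
  open import Data.Fin.Properties using (any?; punchInᵢ≢i; splitAt⁻¹-↑ˡ; splitAt⁻¹-↑ʳ)
  open import Data.Vec.Functional using (_∷_; _++_; insertAt)
  open import Data.Vec.Functional.Properties using (insertAt-lookup; insertAt-punchIn; lookup-++ˡ; lookup-++ʳ)
  open import Data.Bool using (if_then_else_)
  open import Data.Sum using (inj₁; inj₂)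
  open import Data.Product using (Σ; _×_; _,_)
  open import Data.Empty using (⊥-elim)
  open import Data.Rational using (ℚ; 0ℚ; 1ℚ; _+_; _-_; _*_; -_; 1/_; _≤_; _<_; NonZero; ≢-nonZero; positive; negative)
  open import Data.Rational.Properties as ℚ using (+-*-commutativeRing; +-identityˡ; +-identityʳ; +-inverseʳ; *-comm; *-zeroˡ; *-zeroʳ; *-identityʳ; *-inverseʳ; *-distribˡ-+; 1≢0; <-cmp; <-irrefl; ≤-refl; <⇒≤; +-mono-≤; +-mono-<-≤; +-mono-≤-<; pos*pos⇒pos; neg*neg⇒pos; positive⁻¹)
  open import Data.Rational.Solver using (module +-*-Solver)
  open import Algebra.Properties.Semiring.Sum (CommutativeRing.semiring +-*-commutativeRing) using (sum; ∑-distrib-+; ∑-comm; sum-remove; *-distribˡ-sum; *-distribʳ-sum)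
  open import Relation.Binary using (tri<; tri≈; tri>)
  open import Relation.Binary.PropositionalEquality using (_≡_; _≢_; refl; sym; trans; cong; cong₂; module ≡-Reasoning)
  open import Relation.Nullary using (¬_; yes; no; does; ¬?)
  open import Relation.Nullary.Decidable using (dec-true; dec-false; decidable-stable)
  open ≡-Reasoning
  open +-*-Solver using (solve; _:+_; _:*_; :-_; _:=_)

  sumFin≡sum : ∀ {n} (f : Vector n) → sumFin f ≡ sum f
  sumFin≡sum {zero}  f = refl
  sumFin≡sum {suc n} f = cong (f zero +_) (sumFin≡sum (λ i → f (suc i)))

  sumFin-cong : ∀ {n} {f g : Vector n} → (∀ i → f i ≡ g i) → sumFin f ≡ sumFin g
  sumFin-cong {zero}  f≗g = refl
  sumFin-cong {suc n} f≗g = cong₂ _+_ (f≗g zero) (sumFin-cong (λ i → f≗g (suc i)))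

  sumFin-zero : ∀ {n} {f : Vector n} → (∀ i → f i ≡ 0ℚ) → sumFin f ≡ 0ℚ
  sumFin-zero {zero}  f≗0 = refl
  sumFin-zero {suc n} f≗0 = cong₂ _+_ (f≗0 zero) (sumFin-zero (λ i → f≗0 (suc i)))

  sumFin-distrib-+ : ∀ {n} (f g : Vector n) → sumFin (λ i → f i + g i) ≡ sumFin f + sumFin g
  sumFin-distrib-+ f g = begin
    sumFin (λ i → f i + g i) ≡⟨ sumFin≡sum (λ i → f i + g i) ⟩
    sum (λ i → f i + g i)    ≡⟨ ∑-distrib-+ f g ⟩
    sum f + sum g            ≡⟨ sym (cong₂ _+_ (sumFin≡sum f) (sumFin≡sum g)) ⟩
    sumFin f + sumFin g      ∎

  *-distribʳ-sumFin : ∀ {n} x (f : Vector n) → sumFin f * x ≡ sumFin (λ i → f i * x)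
  *-distribʳ-sumFin x f = begin
    sumFin f * x             ≡⟨ cong (_* x) (sumFin≡sum f) ⟩
    sum f * x                ≡⟨ *-distribʳ-sum x f ⟩
    sum (λ i → f i * x)      ≡⟨ sym (sumFin≡sum (λ i → f i * x)) ⟩
    sumFin (λ i → f i * x)   ∎

  *-distribˡ-sumFin : ∀ {n} x (f : Vector n) → x * sumFin f ≡ sumFin (λ i → x * f i)
  *-distribˡ-sumFin x f = begin
    x * sumFin f             ≡⟨ cong (x *_) (sumFin≡sum f) ⟩
    x * sum f                ≡⟨ *-distribˡ-sum x f ⟩
    sum (λ i → x * f i)      ≡⟨ sym (sumFin≡sum (λ i → x * f i)) ⟩
    sumFin (λ i → x * f i)   ∎

  sumFin-comm : ∀ {m n} (f : Fin m → Fin n → ℚ) →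
                sumFin (λ i → sumFin (f i)) ≡ sumFin (λ j → sumFin (λ i → f i j))
  sumFin-comm f = begin
    sumFin (λ i → sumFin (f i))             ≡⟨ sumFin-cong (λ i → sumFin≡sum (f i)) ⟩
    sumFin (λ i → sum (f i))                ≡⟨ sumFin≡sum (λ i → sum (f i)) ⟩
    sum (λ i → sum (f i))                   ≡⟨ ∑-comm f ⟩
    sum (λ j → sum (λ i → f i j))           ≡⟨ sym (sumFin≡sum (λ j → sum (λ i → f i j))) ⟩
    sumFin (λ j → sum (λ i → f i j))        ≡⟨ sym (sumFin-cong (λ j → sumFin≡sum (λ i → f i j))) ⟩
    sumFin (λ j → sumFin (λ i → f i j))     ∎

  sumFin-remove : ∀ {n} (f : Vector (suc n)) i → sumFin f ≡ f i + sumFin (λ j → f (punchIn i j))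
  sumFin-remove f i = begin
    sumFin f                                ≡⟨ sumFin≡sum f ⟩
    sum f                                   ≡⟨ sum-remove f ⟩
    f i + sum (λ j → f (punchIn i j))       ≡⟨ cong (f i +_) (sym (sumFin≡sum (λ j → f (punchIn i j)))) ⟩
    f i + sumFin (λ j → f (punchIn i j))    ∎

  sumFin-pick : ∀ {n} (f : Vector n) i → (∀ j → j ≢ i → f j ≡ 0ℚ) → sumFin f ≡ f i
  sumFin-pick {suc n} f i off-i = begin
    sumFin f                                ≡⟨ sumFin-remove f i ⟩
    f i + sumFin (λ j → f (punchIn i j))    ≡⟨ cong (f i +_) (sumFin-zero (λ j → off-i _ (punchInᵢ≢i i j))) ⟩
    f i + 0ℚ                                ≡⟨ +-identityʳ (f i) ⟩
    f i                                     ∎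

  sumFin-split : ∀ m {n} (f : Vector (m ℕ.+ n)) →
                 sumFin f ≡ sumFin (λ i → f (i ↑ˡ n)) + sumFin (λ j → f (m ↑ʳ j))
  sumFin-split zero    f = sym (+-identityˡ _)
  sumFin-split (suc m) {n} f = begin
    f zero + sumFin (λ i → f (suc i))
      ≡⟨ cong (f zero +_) (sumFin-split m (λ i → f (suc i))) ⟩
    f zero + (sumFin (λ i → f (suc (i ↑ˡ n))) + sumFin (λ j → f (suc (m ↑ʳ j))))
      ≡⟨ sym (ℚ.+-assoc (f zero) _ _) ⟩
    f zero + sumFin (λ i → f (suc (i ↑ˡ n))) + sumFin (λ j → f (suc (m ↑ʳ j))) ∎

  *-cancelʳ-≢0 : ∀ x {y} → y ≢ 0ℚ → x * y ≡ 0ℚ → x ≡ 0ℚ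
  *-cancelʳ-≢0 x {y} y≢0 xy≡0 = begin
    x                 ≡⟨ sym (*-identityʳ x) ⟩
    x * 1ℚ            ≡⟨ cong (x *_) (sym (*-inverseʳ y)) ⟩
    x * (y * y⁻¹)     ≡⟨ sym (ℚ.*-assoc x y y⁻¹) ⟩
    x * y * y⁻¹       ≡⟨ cong (_* y⁻¹) xy≡0 ⟩
    0ℚ * y⁻¹          ≡⟨ *-zeroˡ y⁻¹ ⟩
    0ℚ                ∎
    where
    instance
      y-nonZero : NonZero y
      y-nonZero = ≢-nonZero y≢0
    y⁻¹ : ℚ
    y⁻¹ = 1/ y

  *-≢0 : ∀ {x y} → x ≢ 0ℚ → y ≢ 0ℚ → x * y ≢ 0ℚ
  *-≢0 {x} {y} x≢0 y≢0 xy≡0 = y≢0 (*-cancelʳ-≢0 y x≢0 (trans (*-comm y x) xy≡0))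

  square-pos : ∀ p → p ≢ 0ℚ → 0ℚ < p * p
  square-pos p p≢0 with <-cmp p 0ℚ
  ... | tri< p<0 _ _ = positive⁻¹ (p * p) {{neg*neg⇒pos p {{negative p<0}} p {{negative p<0}}}}
  ... | tri≈ _ p≡0 _ = ⊥-elim (p≢0 p≡0)
  ... | tri> _ _ p>0 = positive⁻¹ (p * p) {{pos*pos⇒pos p {{positive p>0}} p {{positive p>0}}}}

  square-nonneg : ∀ p → 0ℚ ≤ p * p
  square-nonneg p with p ℚ.≟ 0ℚ
  ... | yes refl = ≤-refl
  ... | no p≢0   = <⇒≤ (square-pos p p≢0)

  dot : ∀ {n} → Vector n → Vector n → ℚ
  dot u w = sumFin (λ i → u i * w i)

  lincomb : ∀ {p q} → (Fin q → ℚ) → (Fin q → Vector p) → Vector p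
  lincomb c v i = sumFin (λ j → c j * v j i)

  dot-comm : ∀ {n} (u w : Vector n) → dot u w ≡ dot w u
  dot-comm u w = sumFin-cong (λ i → *-comm (u i) (w i))

  dot-zeroˡ : ∀ {n} {u : Vector n} (w : Vector n) → (∀ i → u i ≡ 0ℚ) → dot u w ≡ 0ℚ
  dot-zeroˡ w u≗0 = sumFin-zero (λ i → trans (cong (_* w _) (u≗0 i)) (*-zeroˡ (w i)))

  dot-zeroʳ : ∀ {n} (u : Vector n) {w : Vector n} → (∀ i → w i ≡ 0ℚ) → dot u w ≡ 0ℚ
  dot-zeroʳ u w≗0 = sumFin-zero (λ i → trans (cong (u i *_) (w≗0 i)) (*-zeroʳ (u i)))

  dot-distribˡ-+ : ∀ {n} (u v w : Vector n) → dot u (λ i → v i + w i) ≡ dot u v + dot u w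
  dot-distribˡ-+ u v w = trans (sumFin-cong (λ i → *-distribˡ-+ (u i) (v i) (w i)))
                               (sumFin-distrib-+ (λ i → u i * v i) (λ i → u i * w i))

  dot-lincomb : ∀ {p q} (u : Vector p) (c : Fin q → ℚ) (v : Fin q → Vector p) →
                dot u (lincomb c v) ≡ sumFin (λ j → c j * dot u (v j))
  dot-lincomb u c v = begin
    sumFin (λ i → u i * sumFin (λ j → c j * v j i))
      ≡⟨ sumFin-cong (λ i → *-distribˡ-sumFin (u i) (λ j → c j * v j i)) ⟩
    sumFin (λ i → sumFin (λ j → u i * (c j * v j i)))
      ≡⟨ sumFin-comm (λ i j → u i * (c j * v j i)) ⟩
    sumFin (λ j → sumFin (λ i → u i * (c j * v j i)))
      ≡⟨ sumFin-cong (λ j → sumFin-cong (λ i → solve 3 (λ u c v → u :* (c :* v) := c :* (u :* v)) refl (u i) (c j) (v j i))) ⟩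
    sumFin (λ j → sumFin (λ i → c j * (u i * v j i)))
      ≡⟨ sumFin-cong (λ j → sym (*-distribˡ-sumFin (c j) (λ i → u i * v j i))) ⟩
    sumFin (λ j → c j * dot u (v j)) ∎

  dot-self-nonneg : ∀ {n} (u : Vector n) → 0ℚ ≤ dot u u
  dot-self-nonneg {zero}  u = ≤-refl
  dot-self-nonneg {suc n} u = +-mono-≤ (square-nonneg (u zero)) (dot-self-nonneg (λ i → u (suc i)))

  dot-self-pos : ∀ {n} (u : Vector n) i → u i ≢ 0ℚ → 0ℚ < dot u u
  dot-self-pos u zero    u₀≢0 = +-mono-<-≤ (square-pos (u zero) u₀≢0) (dot-self-nonneg (λ i → u (suc i)))
  dot-self-pos u (suc i) uᵢ≢0 = +-mono-≤-< (square-nonneg (u zero)) (dot-self-pos (λ i → u (suc i)) i uᵢ≢0)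

  dot-self≢0 : ∀ {n} (u : Vector n) i → u i ≢ 0ℚ → dot u u ≢ 0ℚ
  dot-self≢0 u i uᵢ≢0 u·u≡0 = <-irrefl (sym u·u≡0) (dot-self-pos u i uᵢ≢0)

  dot-self≡0⇒≡0 : ∀ {n} (u : Vector n) → dot u u ≡ 0ℚ → ∀ i → u i ≡ 0ℚ
  dot-self≡0⇒≡0 u u·u≡0 i = decidable-stable (u i ℚ.≟ 0ℚ) (λ uᵢ≢0 → dot-self≢0 u i uᵢ≢0 u·u≡0)

  unit : ∀ {n} → Fin n → Vector n
  unit a b = if does (a Fin.≟ b) then 1ℚ else 0ℚ

  unit-diag : ∀ {n} (a : Fin n) → unit a a ≡ 1ℚ
  unit-diag a = cong (if_then 1ℚ else 0ℚ) (dec-true (a Fin.≟ a) refl)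

  unit-off : ∀ {n} {a b : Fin n} → a ≢ b → unit a b ≡ 0ℚ
  unit-off {a = a} {b} a≢b = cong (if_then 1ℚ else 0ℚ) (dec-false (a Fin.≟ b) a≢b)

  dot-unitˡ : ∀ {n} (a : Fin n) (w : Vector n) → dot (unit a) w ≡ w a
  dot-unitˡ a w = begin
    dot (unit a) w     ≡⟨ sumFin-pick (λ b → unit a b * w b) a off-a ⟩
    unit a a * w a     ≡⟨ cong (_* w a) (unit-diag a) ⟩
    1ℚ * w a           ≡⟨ ℚ.*-identityˡ (w a) ⟩
    w a                ∎
    where
    off-a : ∀ b → b ≢ a → unit a b * w b ≡ 0ℚ
    off-a b b≢a = trans (cong (_* w b) (unit-off (λ a≡b → b≢a (sym a≡b)))) (*-zeroˡ (w b))

  module _ {k n} {e : Fin k → Fin n} (e-injective : ∀ i j → e i ≡ e j → i ≡ j) where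

    lincomb-units-image : ∀ (z : Vector k) t → lincomb z (λ j → unit (e j)) (e t) ≡ z t
    lincomb-units-image z t = begin
      lincomb z (λ j → unit (e j)) (e t)   ≡⟨ sumFin-pick (λ j → z j * unit (e j) (e t)) t off-t ⟩
      z t * unit (e t) (e t)               ≡⟨ cong (z t *_) (unit-diag (e t)) ⟩
      z t * 1ℚ                             ≡⟨ *-identityʳ (z t) ⟩
      z t                                  ∎
      where
      off-t : ∀ j → j ≢ t → z j * unit (e j) (e t) ≡ 0ℚ
      off-t j j≢t = trans (cong (z j *_) (unit-off (λ eⱼ≡eₜ → j≢t (e-injective j t eⱼ≡eₜ)))) (*-zeroʳ (z j))

    ≗lincomb-units : ∀ (x : Vector n) → (∀ v → (∀ j → e j ≢ v) → x v ≡ 0ℚ) →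
                     ∀ v → x v ≡ lincomb (λ i → x (e i)) (λ j → unit (e j)) v
    ≗lincomb-units x vanishes v with any? (λ j → e j Fin.≟ v)
    ... | yes (j , refl) = sym (lincomb-units-image (λ i → x (e i)) j)
    ... | no  v∉image    = begin
      x v                                              ≡⟨ vanishes v (λ j eⱼ≡v → v∉image (j , eⱼ≡v)) ⟩
      0ℚ                                               ≡⟨ sym (dot-zeroʳ (λ i → x (e i)) (λ j → unit-off (λ eⱼ≡v → v∉image (j , eⱼ≡v)))) ⟩
      lincomb (λ i → x (e i)) (λ j → unit (e j)) v    ∎

  dot-lincomb-units : ∀ {k n} (e : Fin k → Fin n) (z : Vector k) (w : Vector n) →
                      dot (lincomb z (λ j → unit (e j))) w ≡ dot z (λ j → w (e j))
  dot-lincomb-units e z w = begin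
    dot (lincomb z (λ j → unit (e j))) w        ≡⟨ dot-comm _ w ⟩
    dot w (lincomb z (λ j → unit (e j)))        ≡⟨ dot-lincomb w z (λ j → unit (e j)) ⟩
    sumFin (λ j → z j * dot w (unit (e j)))     ≡⟨ sumFin-cong (λ j → cong (z j *_) (trans (dot-comm w _) (dot-unitˡ (e j) w))) ⟩
    dot z (λ j → w (e j))                       ∎

  Ker-lincomb : ∀ {m n q} (M : Matrix m n) (c : Fin q → ℚ) {v : Fin q → Vector n} →
                (∀ j → Ker M (v j)) → Ker M (lincomb c v)
  Ker-lincomb M c {v} v∈Ker i = trans (dot-lincomb (M i) c v) (dot-zeroʳ c (λ j → v∈Ker j i))

  LinIndep-∷ : ∀ {p a} {v : Fin a → Vector p} (w z : Vector p) → LinIndep v →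
               (∀ s → dot z (v s) ≡ 0ℚ) → dot z w ≢ 0ℚ → LinIndep (w ∷ v)
  LinIndep-∷ {p} {v = v} w z v-indep z⊥v z·w≢0 α α·wv≡0 = α≡0
    where
    α₀z·w≡0 : α zero * dot z w ≡ 0ℚ
    α₀z·w≡0 = begin
      α zero * dot z w                                   ≡⟨ sym (+-identityʳ _) ⟩
      α zero * dot z w + 0ℚ                              ≡⟨ cong (α zero * dot z w +_) (sym (dot-zeroʳ (λ s → α (suc s)) z⊥v)) ⟩
      sumFin (λ j → α j * dot z ((w ∷ v) j))             ≡⟨ sym (dot-lincomb z α (w ∷ v)) ⟩
      dot z (lincomb α (w ∷ v))                          ≡⟨ dot-zeroʳ z α·wv≡0 ⟩
      0ℚ                                                 ∎
    α₀≡0 : α zero ≡ 0ℚ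
    α₀≡0 = *-cancelʳ-≢0 (α zero) z·w≢0 α₀z·w≡0
    L : Vector p
    L = lincomb (λ s → α (suc s)) v
    L≡0 : ∀ i → L i ≡ 0ℚ
    L≡0 i = begin
      L i                  ≡⟨ sym (+-identityˡ (L i)) ⟩
      0ℚ + L i             ≡⟨ cong (_+ L i) (sym (*-zeroˡ (w i))) ⟩
      0ℚ * w i + L i       ≡⟨ cong (λ a → a * w i + L i) (sym α₀≡0) ⟩
      α zero * w i + L i   ≡⟨ α·wv≡0 i ⟩
      0ℚ                   ∎
    α≡0 : ∀ j → α j ≡ 0ℚ
    α≡0 zero    = α₀≡0
    α≡0 (suc s) = v-indep (λ s → α (suc s)) L≡0 s

  LinIndep-++ : ∀ {p a b} (y : Fin a → Vector p) (c : Fin b → Vector p) → LinIndep y → LinIndep c →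
                (∀ s t → dot (y s) (c t) ≡ 0ℚ) → LinIndep (y ++ c)
  -- Y + C = 0 with Y ∈ span y orthogonal to C ∈ span c gives Y·Y = 0.
  LinIndep-++ {p} {a} {b} y c y-indep c-indep y⊥c α α·yc≡0 = α≡0
    where
    αʸ : Fin a → ℚ
    αʸ s = α (s ↑ˡ b)
    αᶜ : Fin b → ℚ
    αᶜ t = α (a ↑ʳ t)
    Y C : Vector p
    Y = lincomb αʸ y
    C = lincomb αᶜ c
    Y+C≡0 : ∀ i → Y i + C i ≡ 0ℚ
    Y+C≡0 i = begin
      Y i + C i
        ≡⟨ sym (cong₂ _+_ (sumFin-cong (λ s → cong (λ u → αʸ s * u i) (lookup-++ˡ y c s)))
                          (sumFin-cong (λ t → cong (λ u → αᶜ t * u i) (lookup-++ʳ y c t)))) ⟩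
      sumFin (λ s → αʸ s * (y ++ c) (s ↑ˡ b) i) + sumFin (λ t → αᶜ t * (y ++ c) (a ↑ʳ t) i)
        ≡⟨ sym (sumFin-split a (λ j → α j * (y ++ c) j i)) ⟩
      lincomb α (y ++ c) i
        ≡⟨ α·yc≡0 i ⟩
      0ℚ ∎
    Y⊥c : ∀ t → dot Y (c t) ≡ 0ℚ
    Y⊥c t = begin
      dot Y (c t)                          ≡⟨ dot-comm Y (c t) ⟩
      dot (c t) Y                          ≡⟨ dot-lincomb (c t) αʸ y ⟩
      sumFin (λ s → αʸ s * dot (c t) (y s)) ≡⟨ dot-zeroʳ αʸ (λ s → trans (dot-comm (c t) (y s)) (y⊥c s t)) ⟩
      0ℚ                                   ∎
    Y·Y≡0 : dot Y Y ≡ 0ℚ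
    Y·Y≡0 = begin
      dot Y Y                    ≡⟨ sym (+-identityʳ _) ⟩
      dot Y Y + 0ℚ               ≡⟨ cong (dot Y Y +_) (sym (trans (dot-lincomb Y αᶜ c) (dot-zeroʳ αᶜ Y⊥c))) ⟩
      dot Y Y + dot Y C          ≡⟨ sym (dot-distribˡ-+ Y Y C) ⟩
      dot Y (λ i → Y i + C i)    ≡⟨ dot-zeroʳ Y Y+C≡0 ⟩
      0ℚ                         ∎
    Y≡0 : ∀ i → Y i ≡ 0ℚ
    Y≡0 = dot-self≡0⇒≡0 Y Y·Y≡0
    C≡0 : ∀ i → C i ≡ 0ℚ
    C≡0 i = trans (sym (+-identityˡ (C i))) (trans (cong (_+ C i) (sym (Y≡0 i))) (Y+C≡0 i))
    α≡0 : ∀ j → α j ≡ 0ℚ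
    α≡0 j with splitAt a j in eq
    ... | inj₁ s = trans (cong α (sym (splitAt⁻¹-↑ˡ eq))) (y-indep αʸ Y≡0 s)
    ... | inj₂ t = trans (cong α (sym (splitAt⁻¹-↑ʳ eq))) (c-indep αᶜ C≡0 t)

  Dependency : ∀ {p q} → (Fin q → Vector p) → Set
  Dependency {q = q} v = Σ (Fin q → ℚ) λ c → (∀ i → lincomb c v i ≡ 0ℚ) × Σ (Fin q) λ j → c j ≢ 0ℚ

  Dependency⇒¬LinIndep : ∀ {p q} {v : Fin q → Vector p} → Dependency v → ¬ LinIndep v
  Dependency⇒¬LinIndep (c , c·v≡0 , j , cⱼ≢0) v-indep = cⱼ≢0 (v-indep c c·v≡0 j)

  Dependency-tail : ∀ {p q} (v : Fin q → Vector (suc p)) → (∀ j → v j zero ≡ 0ℚ) →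
                    Dependency (λ j i → v j (suc i)) → Dependency v
  Dependency-tail v v₀≡0 (c , c·v≡0 , nonzero) = c , c·v≡0′ , nonzero
    where
    c·v≡0′ : ∀ i → lincomb c v i ≡ 0ℚ
    c·v≡0′ zero    = dot-zeroʳ c v₀≡0
    c·v≡0′ (suc i) = c·v≡0 i

  eliminate : ∀ {p q} → (Fin (suc q) → Vector (suc p)) → Fin (suc q) → Fin q → Vector (suc p)
  eliminate v j₀ j i = v j₀ zero * v (punchIn j₀ j) i - v (punchIn j₀ j) zero * v j₀ i

  eliminate-pivot : ∀ {p q} (v : Fin (suc q) → Vector (suc p)) j₀ j → eliminate v j₀ j zero ≡ 0ℚ
  eliminate-pivot v j₀ j = trans (cong (λ t → a * b - t) (*-comm b a)) (+-inverseʳ (a * b))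
    where
    a b : ℚ
    a = v j₀ zero
    b = v (punchIn j₀ j) zero

  Dependency-uneliminate : ∀ {p q} (v : Fin (suc q) → Vector (suc p)) j₀ → v j₀ zero ≢ 0ℚ →
                           Dependency (eliminate v j₀) → Dependency v
  Dependency-uneliminate {q = q} v j₀ a≢0 (d , d·w≡0 , j₁ , d₁≢0) =
    c , (λ i → trans (c·v≡d·w i) (d·w≡0 i)) , punchIn j₀ j₁ , c-nonzero
    where
    a : ℚ
    a = v j₀ zero
    b : Vector q
    b j = v (punchIn j₀ j) zero
    c : Fin (suc q) → ℚ
    c = insertAt (λ j → a * d j) j₀ (- dot d b)
    c·v≡d·w : ∀ i → lincomb c v i ≡ lincomb d (eliminate v j₀) i
    c·v≡d·w i = begin
      lincomb c v i
        ≡⟨ sumFin-remove (λ j → c j * v j i) j₀ ⟩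
      c j₀ * v j₀ i + sumFin (λ j → c (punchIn j₀ j) * x j)
        ≡⟨ cong₂ _+_ (cong (_* v j₀ i) (insertAt-lookup _ j₀ _))
                     (sumFin-cong (λ j → cong (_* x j) (insertAt-punchIn _ j₀ _ j))) ⟩
      - dot d b * v j₀ i + sumFin (λ j → a * d j * x j)
        ≡⟨ solve 3 (λ s y t → :- s :* y :+ t := t :+ s :* (:- y)) refl (dot d b) (v j₀ i) _ ⟩
      sumFin (λ j → a * d j * x j) + dot d b * - v j₀ i
        ≡⟨ cong (sumFin (λ j → a * d j * x j) +_) (*-distribʳ-sumFin (- v j₀ i) (λ j → d j * b j)) ⟩
      sumFin (λ j → a * d j * x j) + sumFin (λ j → d j * b j * - v j₀ i)
        ≡⟨ sym (sumFin-distrib-+ (λ j → a * d j * x j) (λ j → d j * b j * - v j₀ i)) ⟩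
      sumFin (λ j → a * d j * x j + d j * b j * - v j₀ i)
        ≡⟨ sumFin-cong (λ j → solve 5 (λ a d x b y → a :* d :* x :+ d :* b :* (:- y) := d :* (a :* x :+ :- (b :* y)))
                                     refl a (d j) (x j) (b j) (v j₀ i)) ⟩
      lincomb d (eliminate v j₀) i ∎
      where
      x : Vector q
      x j = v (punchIn j₀ j) i
    c-nonzero : c (punchIn j₀ j₁) ≢ 0ℚ
    c-nonzero cⱼ≡0 = *-≢0 a≢0 d₁≢0 (trans (sym (insertAt-punchIn _ j₀ _ j₁)) cⱼ≡0)

  <⇒Dependency : ∀ {p q} (v : Fin q → Vector p) → p ℕ.< q → Dependency v
  <⇒Dependency {zero}  {suc q} v _ = (λ _ → 1ℚ) , (λ ()) , zero , 1≢0
  <⇒Dependency {suc p} {suc q} v (s≤s p<q) with any? (λ j → ¬? (v j zero ℚ.≟ 0ℚ))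
  ... | yes (j₀ , pivot≢0) =
    Dependency-uneliminate v j₀ pivot≢0
      (Dependency-tail (eliminate v j₀) (eliminate-pivot v j₀)
        (<⇒Dependency (λ j i → eliminate v j₀ j (suc i)) p<q))
  ... | no  no-pivot =
    Dependency-tail v (λ j → decidable-stable (v j zero ℚ.≟ 0ℚ) (λ vⱼ≢0 → no-pivot (j , vⱼ≢0)))
      (<⇒Dependency (λ j i → v j (suc i)) (ℕ.m<n⇒m<1+n p<q))

  column : ∀ {k m} → Matrix k m → Fin m → Vector k
  column Q l i = Q i l

  LeftKer : ∀ {k m} → Matrix k m → Vector k → Set
  LeftKer Q z = ∀ l → dot z (column Q l) ≡ 0ℚ

  LeftKer⊥ColSpace : ∀ {k m} (Q : Matrix k m) {z y : Vector k} → LeftKer Q z → ColSpace Q y → dot z y ≡ 0ℚ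
  LeftKer⊥ColSpace Q {z} {y} z∈LeftKer (x , Qx≡y) = begin
    dot z y                                 ≡⟨ sumFin-cong (λ i → cong (z i *_) (sym (Qx≡y i))) ⟩
    dot z (Q · x)                           ≡⟨ sumFin-cong (λ i → cong (z i *_) (dot-comm (Q i) x)) ⟩
    dot z (lincomb x (column Q))            ≡⟨ dot-lincomb z x (column Q) ⟩
    sumFin (λ l → x l * dot z (column Q l)) ≡⟨ dot-zeroʳ x z∈LeftKer ⟩
    0ℚ                                      ∎

  column∈ColSpace : ∀ {k m} (Q : Matrix k m) l → ColSpace Q (column Q l)
  column∈ColSpace Q l = unit l , λ i → trans (dot-comm (Q i) (unit l)) (dot-unitˡ l (Q i))

  LinIndep-LeftKer+rank≤ : ∀ {k m a r} (Q : Matrix k m) (y : Fin a → Vector k) →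
                           (∀ s → LeftKer Q (y s)) → LinIndep y → IsRank Q r → a ℕ.+ r ℕ.≤ k
  LinIndep-LeftKer+rank≤ Q y y∈LeftKer y-indep ((c , c∈ColSpace , c-indep) , _) =
    ℕ.≮⇒≥ λ k<a+r → Dependency⇒¬LinIndep (<⇒Dependency (y ++ c) k<a+r)
      (LinIndep-++ y c y-indep c-indep (λ s t → LeftKer⊥ColSpace Q {y s} (y∈LeftKer s) (c∈ColSpace t)))

  LeftKer-extension : ∀ {k m a r} (Q : Matrix k m) (y : Fin a → Vector k) → IsRank Q r → a ℕ.+ r ℕ.< k →
                      Σ (Vector k) λ z → LeftKer Q z × (∀ s → dot z (y s) ≡ 0ℚ) × dot z z ≢ 0ℚ
  -- z solves the a + r equations z·y s = 0, z·c t = 0 in k unknowns; a column of Q not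
  -- orthogonal to z would extend the basis c of the column space.
  LeftKer-extension {a = a} {r} Q y ((c , c∈ColSpace , c-indep) , rank-maximal) a+r<k
    with <⇒Dependency (λ i t → (y ++ c) t i) a+r<k
  ... | z , z⊥yc , i , zᵢ≢0 = z , z∈LeftKer , z⊥y , dot-self≢0 z i zᵢ≢0
    where
    z⊥y : ∀ s → dot z (y s) ≡ 0ℚ
    z⊥y s = trans (cong (dot z) (sym (lookup-++ˡ y c s))) (z⊥yc (s ↑ˡ r))
    z⊥c : ∀ t → dot z (c t) ≡ 0ℚ
    z⊥c t = trans (cong (dot z) (sym (lookup-++ʳ y c t))) (z⊥yc (a ↑ʳ t))
    z∈LeftKer : LeftKer Q z
    z∈LeftKer l = decidable-stable (dot z (column Q l) ℚ.≟ 0ℚ) λ z·Qₗ≢0 →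
      rank-maximal (column Q l ∷ c , ∷-ColSpace , LinIndep-∷ (column Q l) z c-indep z⊥c z·Qₗ≢0)
      where
      ∷-ColSpace : ∀ j → ColSpace Q ((column Q l ∷ c) j)
      ∷-ColSpace zero    = column∈ColSpace Q l
      ∷-ColSpace (suc t) = c∈ColSpace t

module CoreVertices {n} (G : SimpleGraph n) {k} (cv : Fin k → Fin n) (cv-enumerates : Enumerates (IsCore G) cv) where

  open import Data.Bool using (true; if_then_else_)
  open import Data.Bool.Properties using (¬-not)
  open import Data.Fin.Properties using (any?)
  open import Data.Product using (Σ; _,_; proj₁; proj₂; uncurry)
  open import Data.Rational using (0ℚ; 1ℚ; _*_)
  open import Data.Rational.Properties using (_≟_)
  open import Data.Vec.Functional using (_∷_)
  open import Relation.Binary.PropositionalEquality using (_≡_; _≢_; refl; sym; trans; cong; module ≡-Reasoning)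
  open import Relation.Nullary using (¬_; yes; no)
  open import Relation.Nullary.Decidable using (decidable-stable)
  open ≡-Reasoning
  open LinearAlgebra

  private
    A : Matrix n n
    A = adjMat G

  adjMat-sym : ∀ u v → A u v ≡ A v u
  adjMat-sym u v = cong (if_then 1ℚ else 0ℚ) (SimpleGraph.sym G u v)

  lift : Vector k → Vector n
  lift z = lincomb z (λ j → unit (cv j))

  Ker-vanishes-off-core : ∀ {x} → Ker A x → ∀ v → ¬ IsCore G v → x v ≡ 0ℚ
  Ker-vanishes-off-core {x} x∈Ker v ¬core = decidable-stable (x v ≟ 0ℚ) (λ xᵥ≢0 → ¬core (x , x∈Ker , xᵥ≢0))

  Ker≗lift : ∀ {x} → Ker A x → ∀ v → x v ≡ lift (λ i → x (cv i)) v
  Ker≗lift {x} x∈Ker = ≗lincomb-units (proj₁ cv-enumerates) x λ v v∉CV →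
    Ker-vanishes-off-core x∈Ker v (λ core → uncurry v∉CV (proj₁ (proj₂ cv-enumerates) v core))

  Ker-restriction-LinIndep : ∀ {a} {xs : Fin a → Vector n} → (∀ s → Ker A (xs s)) → LinIndep xs →
                             LinIndep (λ s i → xs s (cv i))
  Ker-restriction-LinIndep {xs = xs} xs∈Ker xs-indep α α·xs∘cv≡0 = xs-indep α λ v →
    trans (Ker≗lift (Ker-lincomb A α xs∈Ker) v) (dot-zeroˡ _ α·xs∘cv≡0)

  Ker-restriction-LeftKer : ∀ {m} (ncv : Fin m → Fin n) {x} → Ker A x →
                            LeftKer (subMatrix A cv ncv) (λ i → x (cv i))
  Ker-restriction-LeftKer ncv {x} x∈Ker l = begin
    dot (λ i → x (cv i)) (λ i → A (cv i) (ncv l))   ≡⟨ sumFin-cong (λ i → cong (x (cv i) *_) (adjMat-sym (cv i) (ncv l))) ⟩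
    dot (λ i → x (cv i)) (λ i → A (ncv l) (cv i))   ≡⟨ sym (dot-lincomb-units cv (λ i → x (cv i)) (A (ncv l))) ⟩
    dot (lift (λ i → x (cv i))) (A (ncv l))         ≡⟨ sumFin-cong (λ v → cong (_* A (ncv l) v) (sym (Ker≗lift x∈Ker v))) ⟩
    dot x (A (ncv l))                               ≡⟨ dot-comm x (A (ncv l)) ⟩
    (A · x) (ncv l)                                 ≡⟨ x∈Ker (ncv l) ⟩
    0ℚ                                              ∎

  LeftKer-lift-Ker : ∀ {m} {ncv : Fin m → Fin n} → (∀ v → InNCV G v → Σ (Fin m) λ l → ncv l ≡ v) →
                     ∀ z → LeftKer (subMatrix A cv ncv) z → Ker A (lift z)
  LeftKer-lift-Ker {ncv = ncv} ncv-onto z z∈LeftKer u = begin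
    (A · lift z) u                ≡⟨ dot-comm (A u) (lift z) ⟩
    dot (lift z) (A u)            ≡⟨ dot-lincomb-units cv z (A u) ⟩
    dot z (λ j → A u (cv j))      ≡⟨ z⊥core-row ⟩
    0ℚ                            ∎
    where
    z⊥core-row : dot z (λ j → A u (cv j)) ≡ 0ℚ
    z⊥core-row with any? (λ j → adj G (cv j) u Data.Bool.≟ true)
    ... | yes (j , cvⱼ~u) with ncv-onto u (cv j , proj₂ (proj₂ cv-enumerates) j , cvⱼ~u)
    ...   | l , refl = trans (sumFin-cong (λ i → cong (z i *_) (adjMat-sym (ncv l) (cv i)))) (z∈LeftKer l)
    z⊥core-row | no u∉NCV = dot-zeroʳ z λ j →
      trans (adjMat-sym u (cv j)) (cong (if_then 1ℚ else 0ℚ) (¬-not (λ cvⱼ~u → u∉NCV (j , cvⱼ~u))))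

  lift-∷-LinIndep : ∀ {a} {xs : Fin a → Vector n} (z : Vector k) → LinIndep xs →
                    (∀ s → dot z (λ i → xs s (cv i)) ≡ 0ℚ) → dot z z ≢ 0ℚ → LinIndep (lift z ∷ xs)
  lift-∷-LinIndep {xs = xs} z xs-indep z⊥xs z·z≢0 =
    LinIndep-∷ (lift z) (lift z) xs-indep (λ s → trans (dot-lincomb-units cv z (xs s)) (z⊥xs s))
      (λ lz·lz≡0 → z·z≢0 (trans (sym lz·lz≡z·z) lz·lz≡0))
    where
    lz·lz≡z·z : dot (lift z) (lift z) ≡ dot z z
    lz·lz≡z·z = trans (dot-lincomb-units cv z (lift z))
                      (sumFin-cong (λ i → cong (z i *_) (lincomb-units-image (proj₁ cv-enumerates) z i)))

open import Data.Nat using (ℕ; _<_; _+_)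
open import Data.Nat.Properties using (≤-antisym; ≮⇒≥)
open import Data.Product using (_,_)
open import Data.Vec.Functional using (_∷_)
open import Relation.Binary.PropositionalEquality using (_≡_)
open LinearAlgebra using (LeftKer; LinIndep-LeftKer+rank≤; LeftKer-extension)

mainTheorem4 : ∀ {n} (G : SimpleGraph n) (η : ℕ) → IsNullity G η → 0 < η
               → CoreIndependent G
               → (k : ℕ) (cv : Fin k → Fin n) → Enumerates (IsCore G) cv
               → (m : ℕ) (ncv : Fin m → Fin n) → Enumerates (InNCV G) ncv
               → (r : ℕ) → IsRank (subMatrix (adjMat G) cv ncv) r
               → η + r ≡ k
mainTheorem4 G η ((xs , xs∈Ker , xs-indep) , η-maximal) _ _ k cv cv-enumerates m ncv (_ , ncv-onto , _) r rank =
  ≤-antisym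
    (LinIndep-LeftKer+rank≤ Q ys (λ s → Ker-restriction-LeftKer ncv (xs∈Ker s)) (Ker-restriction-LinIndep xs∈Ker xs-indep) rank)
    (≮⇒≥ λ η+r<k → let (z , z∈LeftKer , z⊥ys , z·z≢0) = LeftKer-extension Q ys rank η+r<k in
      η-maximal (lift z ∷ xs , extended-in-Ker z z∈LeftKer , lift-∷-LinIndep z xs-indep z⊥ys z·z≢0))
  where
  open CoreVertices G cv cv-enumerates
  Q : Matrix k m
  Q = subMatrix (adjMat G) cv ncv
  ys : Fin η → Vector k
  ys s i = xs s (cv i)
  extended-in-Ker : ∀ z → LeftKer Q z → ∀ j → Ker (adjMat G) ((lift z ∷ xs) j)
  extended-in-Ker z z∈LeftKer zero    = LeftKer-lift-Ker ncv-onto z z∈LeftKer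
  extended-in-Ker z z∈LeftKer (suc s) = xs∈Ker s
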